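{- Let $g,n\in\mathbb{N}$ with $g>3$ and $2\le n\le g-2$, and let $S$ be a non special numerical semigroup with $\operatorname{g}(S)=g$ and $\operatorname{n}(S)=n$. Let $h=\max(\operatorname{SG}(S)\setminus\{\operatorname{F}(S)\})$ and $T=(S\cup\{h\})\setminus\{\operatorname{m}(S)\}$. Then $\operatorname{m}(S)\in\operatorname{SG}(T)$, $\operatorname{m}(S)<\operatorname{m}(T)$, and $h$ is a minimal generator of $T\cup\{\operatorname{m}(S)\}$ such that: (i) if $S\cup\{h\}$ is irreducible, then $\frac{\operatorname{F}(T)}{2}<h<\operatorname{F}(T)$; (ii) if $S\cup\{h\}$ is not irreducible, then $\max\big(\operatorname{SG}(T\cup\{\operatorname{m}(S)\})\setminus\{\operatorname{F}(T)\}\big)<h<\operatorname{F}(T)$.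
   Context: $\mathbb{N}=\{0,1,2,\ldots\}$. A numerical semigroup is a submonoid $S$ of $(\mathbb{N},+)$ with $\mathbb{N}\setminus S$ finite; a minimal generator is an element of $S\setminus\{0\}$ not expressible as a sum of two elements of $S\setminus\{0\}$. $\operatorname{H}(S)=\mathbb{N}\setminus S$; $\operatorname{g}(S)=|\operatorname{H}(S)|$; $\operatorname{F}(S)=\max\operatorname{H}(S)$; $\operatorname{m}(S)=\min(S\setminus\{0\})$; $\operatorname{n}(S)=|\{s\in S\mid s<\operatorname{F}(S)\}|$. Special gaps: $\operatorname{SG}(S)=\{h\in\operatorname{H}(S)\mid 2h\in S \text{ and } h+s\in S \text{ for all } s\in S\setminus\{0\}\}$. $S$ is special if there is no $h\in\operatorname{SG}(S)\setminus\{\operatorname{F}(S)\}$ with $h>\operatorname{m}(S)$. $S$ is irreducible if it cannot be written as the intersection of two numerical semigroups properly containing $S$. -}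

module Defs where

open import Data.Nat using (ℕ; zero; suc; _+_; _*_; _≤_; _<_; _≡ᵇ_)
open import Data.Bool using (Bool; true; false; not; _∧_; _∨_; if_then_else_)
open import Data.Product using (Σ; ∃; _×_; _,_)
open import Relation.Binary.PropositionalEquality using (_≡_; _≢_)
open import Relation.Nullary using (¬_)

Subset : Set
Subset = ℕ → Bool

infix 4 _∈_ _∉_
_∈_ : ℕ → Subset → Set
x ∈ A = A x ≡ true

_∉_ : ℕ → Subset → Set
x ∉ A = A x ≡ false

_∪｛_｝ : Subset → ℕ → Subset
(A ∪｛ h ｝) x = A x ∨ (x ≡ᵇ h)

_∖｛_｝ : Subset → ℕ → Subset
(A ∖｛ h ｝) x = A x ∧ not (x ≡ᵇ h)

_⊆_ : Subset → Subset → Set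
A ⊆ B = ∀ x → x ∈ A → x ∈ B

_⊊_ : Subset → Subset → Set
A ⊊ B = A ⊆ B × Σ ℕ (λ x → x ∈ B × x ∉ A)

_∩_ : Subset → Subset → Subset
(A ∩ B) x = A x ∧ B x

_≐_ : Subset → Subset → Set
A ≐ B = ∀ x → A x ≡ B x

record IsNumSG (S : Subset) : Set where
  field
    zero∈ : 0 ∈ S
    closed : ∀ a b → a ∈ S → b ∈ S → (a + b) ∈ S
    cofinite : Σ ℕ λ c → ∀ x → c ≤ x → x ∈ S

countBelow : (ℕ → Bool) → ℕ → ℕ
countBelow P zero = 0
countBelow P (suc k) = (if P k then 1 else 0) + countBelow P k

HasGenus : Subset → ℕ → Set
HasGenus S g = Σ ℕ λ c → (∀ x → c ≤ x → x ∈ S) × countBelow (λ x → not (S x)) c ≡ g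

IsFrobenius : Subset → ℕ → Set
IsFrobenius S f = f ∉ S × (∀ x → f < x → x ∈ S)

IsMultiplicity : Subset → ℕ → Set
IsMultiplicity S m = 0 < m × m ∈ S × (∀ x → 0 < x → x < m → x ∉ S)

-- n(S) = |{ s ∈ S | s < F(S) }|, given F(S) = f
HasN : Subset → ℕ → ℕ → Set
HasN S f n = countBelow S f ≡ n

IsSpecialGap : Subset → ℕ → Set
IsSpecialGap S h = h ∉ S × (2 * h) ∈ S × (∀ s → s ∈ S → s ≢ 0 → (h + s) ∈ S)

IsSpecial : Subset → ℕ → ℕ → Set
IsSpecial S f m = ¬ (Σ ℕ λ h → IsSpecialGap S h × h ≢ f × m < h)

IsMax : (ℕ → Set) → ℕ → Set
IsMax P k = P k × (∀ y → P y → y ≤ k)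

IsMinimalGenerator : Subset → ℕ → Set
IsMinimalGenerator S x =
  x ∈ S × x ≢ 0 ×
  ¬ (Σ ℕ λ a → Σ ℕ λ b → a ∈ S × a ≢ 0 × b ∈ S × b ≢ 0 × a + b ≡ x)

Irreducible : Subset → Set
Irreducible S = IsNumSG S ×
  ¬ (Σ Subset λ A → Σ Subset λ B →
       IsNumSG A × IsNumSG B × S ⊊ A × S ⊊ B × S ≐ (A ∩ B))

-- f < 2h holds even without irreducibility: if 2h < f, the gap y = f − h exceeds h, and for
-- d ∈ S maximal with y + d ∉ S, y + d is a pseudo-Frobenius number with 2(y + d) > f, hence
-- a special gap other than f larger than h.
-- For (ii): if R ⊊ A are numerical semigroups, the largest element of A ∖ R is a special gap
-- of R, so a semigroup whose only special gap is its Frobenius number f lies properly only in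
-- semigroups containing f, and is irreducible. Hence S ∪ {h} has a special gap k ≠ f, and
-- k > h would make k a special gap of S.
{-# OPTIONS --safe #-}
module Submission where

open import Defs
open import Data.Nat using (ℕ; zero; suc; _+_; _*_; _≤_; _<_; _∸_; _≡ᵇ_; z≤n; s≤s; s≤s⁻¹; z<s)
open import Data.Nat.Properties
open import Data.Bool using (true; false; _∧_)
open import Data.Bool.Properties using (∨-zeroʳ; ∨-identityʳ; ∧-zeroʳ; ∧-identityʳ)
  renaming (_≟_ to _≟ᴮ_)
open import Data.Product using (Σ; _×_; _,_; proj₁; proj₂; map₁)
open import Data.Sum using (_⊎_; inj₁; inj₂)
open import Data.Empty using (⊥; ⊥-elim)
open import Function using (_∘_)
open import Relation.Binary.PropositionalEquality
  using (_≡_; _≢_; refl; sym; trans; cong; cong₂; subst; subst₂; ≢-sym)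
open import Relation.Nullary using (¬_; Dec; yes; no)
open import Relation.Nullary.Decidable using (map′; _×-dec_; _→-dec_; ¬?; decidable-stable)
open import Relation.Nullary.Reflects using (Reflects; ofʸ; ofⁿ; fromEquivalence)
open import Relation.Unary using (Decidable)

2*m≡m+m : ∀ m → 2 * m ≡ m + m
2*m≡m+m m = cong (m +_) (+-identityʳ m)

m+n≤m⇒n≡0 : ∀ m {n} → m + n ≤ m → n ≡ 0
m+n≤m⇒n≡0 m {n} m+n≤m =
  n≤0⇒n≡0 (+-cancelˡ-≤ m n 0 (≤-trans m+n≤m (≤-reflexive (sym (+-identityʳ m)))))

m+n≡m⇒n≡0 : ∀ m {n} → m + n ≡ m → n ≡ 0
m+n≡m⇒n≡0 m = m+n≤m⇒n≡0 m ∘ ≤-reflexive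

≡ᵇ-reflects-≡ : ∀ m n → Reflects (m ≡ n) (m ≡ᵇ n)
≡ᵇ-reflects-≡ m n = fromEquivalence (≡ᵇ⇒≡ m n) (≡⇒≡ᵇ m n)

≡⇒≡ᵇ≡true : ∀ {m n} → m ≡ n → (m ≡ᵇ n) ≡ true
≡⇒≡ᵇ≡true {m} {n} m≡n with m ≡ᵇ n | ≡ᵇ-reflects-≡ m n
... | true  | _        = refl
... | false | ofⁿ m≢n = ⊥-elim (m≢n m≡n)

≢⇒≡ᵇ≡false : ∀ {m n} → m ≢ n → (m ≡ᵇ n) ≡ false
≢⇒≡ᵇ≡false {m} {n} m≢n with m ≡ᵇ n | ≡ᵇ-reflects-≡ m n
... | true  | ofʸ m≡n = ⊥-elim (m≢n m≡n)
... | false | _        = refl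

infix 4 _∈?_ _∉?_

_∈?_ : ∀ x A → Dec (x ∈ A)
x ∈? A = A x ≟ᴮ true

_∉?_ : ∀ x A → Dec (x ∉ A)
x ∉? A = A x ≟ᴮ false

∈∧∉⇒⊥ : ∀ A {x} → x ∈ A → x ∉ A → ⊥
∈∧∉⇒⊥ _ x∈A x∉A with trans (sym x∈A) x∉A
... | ()

¬∈⇒∉ : ∀ A {x} → ¬ x ∈ A → x ∉ A
¬∈⇒∉ A {x} x∉A with A x
... | true  = ⊥-elim (x∉A refl)
... | false = refl

¬∉⇒∈ : ∀ A {x} → ¬ x ∉ A → x ∈ A
¬∉⇒∈ A {x} x∈A with A x
... | true  = refl
... | false = ⊥-elim (x∈A refl)

∈-∪｛｝⁺ˡ : ∀ A {h x} → x ∈ A → x ∈ A ∪｛ h ｝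
∈-∪｛｝⁺ˡ _ x∈A rewrite x∈A = refl

∈-∪｛｝⁺ʳ : ∀ A {h x} → x ≡ h → x ∈ A ∪｛ h ｝
∈-∪｛｝⁺ʳ A {x = x} x≡h rewrite ≡⇒≡ᵇ≡true x≡h = ∨-zeroʳ (A x)

∈-∪｛｝⁻ : ∀ A {h x} → x ∈ A ∪｛ h ｝ → x ∈ A ⊎ x ≡ h
∈-∪｛｝⁻ A {h} {x} x∈ with A x | x ≡ᵇ h | ≡ᵇ-reflects-≡ x h
... | true  | _    | _       = inj₁ refl
... | false | true | ofʸ x≡h = inj₂ x≡h

∉-∪｛｝ : ∀ A {h x} → x ∉ A → x ≢ h → x ∉ A ∪｛ h ｝
∉-∪｛｝ _ x∉A x≢h rewrite x∉A | ≢⇒≡ᵇ≡false x≢h = refl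

∈-∖｛｝⁺ : ∀ A {m x} → x ∈ A → x ≢ m → x ∈ A ∖｛ m ｝
∈-∖｛｝⁺ _ x∈A x≢m rewrite x∈A | ≢⇒≡ᵇ≡false x≢m = refl

∈-∖｛｝⁻ : ∀ A {m x} → x ∈ A ∖｛ m ｝ → x ∈ A × x ≢ m
∈-∖｛｝⁻ A {m} {x} x∈ with A x | x ≡ᵇ m | ≡ᵇ-reflects-≡ x m
... | true | false | ofⁿ x≢m = refl , x≢m

∉-∖｛｝ : ∀ A {m x} → x ∉ A → x ∉ A ∖｛ m ｝
∉-∖｛｝ _ x∉A rewrite x∉A = refl

m∉-∖｛m｝ : ∀ A {m} → m ∉ A ∖｛ m ｝
m∉-∖｛m｝ A {m} rewrite ≡⇒≡ᵇ≡true {m} refl = ∧-zeroʳ (A m)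

∖｛｝-∪｛｝-≐ : ∀ {A m} → m ∈ A → ((A ∖｛ m ｝) ∪｛ m ｝) ≐ A
∖｛｝-∪｛｝-≐ {A} {m} m∈A x with x ≟ m
... | yes refl rewrite ≡⇒≡ᵇ≡true {m} refl = trans (∨-zeroʳ _) (sym m∈A)
... | no x≢m   rewrite ≢⇒≡ᵇ≡false x≢m = trans (∨-identityʳ _) (∧-identityʳ (A x))

≐-sym : ∀ {A B} → A ≐ B → B ≐ A
≐-sym A≐B x = sym (A≐B x)

∈-resp-≐ : ∀ {A B x} → A ≐ B → x ∈ A → x ∈ B
∈-resp-≐ {x = x} A≐B = trans (sym (A≐B x))

∉-resp-≐ : ∀ {A B x} → A ≐ B → x ∉ A → x ∉ B
∉-resp-≐ {x = x} A≐B = trans (sym (A≐B x))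

module _ {P : ℕ → Set} (P? : Decidable P) where

  maximum : ∀ N → (∀ y → P y → y < N) → ∀ w → P w → Σ ℕ (IsMax P)
  maximum zero    bound w Pw = ⊥-elim (n≮0 (bound w Pw))
  maximum (suc N) bound w Pw with P? N
  ... | yes PN = N , PN , λ y Py → s≤s⁻¹ (bound y Py)
  ... | no ¬PN = maximum N bound′ w Pw
    where
    bound′ : ∀ y → P y → y < N
    bound′ y Py = ≤∧≢⇒< (s≤s⁻¹ (bound y Py)) λ { refl → ¬PN Py }

  minimum : ∀ w → P w → Σ ℕ λ k → P k × (∀ y → y < k → ¬ P y)
  minimum w Pw = minimumBelow (suc w) w ≤-refl Pw
    where
    minimumBelow : ∀ N w → w < N → P w → Σ ℕ λ k → P k × (∀ y → y < k → ¬ P y)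
    minimumBelow (suc N) w w<1+N Pw with anyUpTo? P? N
    ... | yes (y , y<N , Py) = minimumBelow N y y<N Py
    ... | no none = w , Pw , λ y y<w Py → none (y , <-≤-trans y<w (s≤s⁻¹ w<1+N) , Py)

IsMax-cong : ∀ {P Q : ℕ → Set} {k} → (∀ {y} → P y → Q y) → (∀ {y} → Q y → P y) →
             IsMax P k → IsMax Q k
IsMax-cong P⇒Q Q⇒P (Pk , maximal) = P⇒Q Pk , λ y Qy → maximal y (Q⇒P Qy)

IsPseudoFrobenius : Subset → ℕ → Set
IsPseudoFrobenius S p = p ∉ S × (∀ s → s ∈ S → s ≢ 0 → p + s ∈ S)

open IsNumSG

gap≤Frobenius : ∀ S {f x} → IsFrobenius S f → x ∉ S → x ≤ f
gap≤Frobenius S (_ , above) x∉S = ≮⇒≥ λ f<x → ∈∧∉⇒⊥ S (above _ f<x) x∉S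

specialGap<Frobenius : ∀ S {f h} → IsFrobenius S f → IsSpecialGap S h → h ≢ f → h < f
specialGap<Frobenius S frob (h∉S , _) = ≤∧≢⇒< (gap≤Frobenius S frob h∉S)

multiplicity≤ : ∀ S {m x} → IsMultiplicity S m → x ∈ S → x ≢ 0 → m ≤ x
multiplicity≤ S (_ , _ , below) x∈S x≢0 = ≮⇒≥ λ x<m → ∈∧∉⇒⊥ S x∈S (below _ (n≢0⇒n>0 x≢0) x<m)

multiplicity-exists : ∀ {S} → IsNumSG S → Σ ℕ (IsMultiplicity S)
multiplicity-exists {S} numS =
  let c , above = cofinite numS
      m , (0<m , m∈S) , below = minimum P? (suc c) (s≤s z≤n , above (suc c) (n≤1+n c))
  in m , 0<m , m∈S , λ x 0<x x<m → ¬∈⇒∉ S λ x∈S → below x x<m (0<x , x∈S)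
  where
  P? : Decidable (λ y → 0 < y × y ∈ S)
  P? y = 0 <? y ×-dec y ∈? S

isSpecialGap? : ∀ {S f} → IsFrobenius S f → Decidable (IsSpecialGap S)
isSpecialGap? {S} {f} (_ , above) y =
  y ∉? S ×-dec 2 * y ∈? S ×-dec map′ (λ Q<1+f → extend (λ {s} → Q<1+f {s})) (λ Q {s} _ → Q s)
                                   (allUpTo? Q? (suc f))
  where
  Q : ℕ → Set
  Q s = s ∈ S → s ≢ 0 → y + s ∈ S
  Q? : Decidable Q
  Q? s = s ∈? S →-dec ¬? (s ≟ 0) →-dec y + s ∈? S
  extend : (∀ {s} → s < suc f → Q s) → ∀ s → Q s
  extend Q<1+f s with s <? suc f
  ... | yes s<1+f = Q<1+f s<1+f
  ... | no s≮1+f  = λ _ _ → above (y + s) (<-≤-trans (≮⇒≥ s≮1+f) (m≤n+m s y))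

IsSpecialGap-resp-≐ : ∀ {A B y} → A ≐ B → IsSpecialGap A y → IsSpecialGap B y
IsSpecialGap-resp-≐ A≐B (y∉A , 2y∈A , y+A⊆A) =
  ∉-resp-≐ A≐B y∉A , ∈-resp-≐ A≐B 2y∈A ,
  λ s s∈B s≢0 → ∈-resp-≐ A≐B (y+A⊆A s (∈-resp-≐ (≐-sym A≐B) s∈B) s≢0)

IsMinimalGenerator-resp-≐ : ∀ {A B x} → A ≐ B → IsMinimalGenerator A x → IsMinimalGenerator B x
IsMinimalGenerator-resp-≐ A≐B (x∈A , x≢0 , indecomposable) =
  ∈-resp-≐ A≐B x∈A , x≢0 ,
  λ (a , b , a∈B , a≢0 , b∈B , b≢0 , a+b≡x) →
    indecomposable (a , b , ∈-resp-≐ (≐-sym A≐B) a∈B , a≢0 , ∈-resp-≐ (≐-sym A≐B) b∈B , b≢0 , a+b≡x)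

pseudoFrobenius-above : ∀ {S f y} → IsNumSG S → IsFrobenius S f → y ∉ S →
                        Σ ℕ λ d → d ∈ S × IsPseudoFrobenius S (y + d)
pseudoFrobenius-above {S} {f} {y} numS frob y∉S =
  let d , (d∈S , y+d∉S) , maximal = maximum P? (suc f) bound 0 (zero∈ numS , y+0∉S)
  in d , d∈S , y+d∉S , λ s s∈S s≢0 → ¬∉⇒∈ S λ y+d+s∉S →
       s≢0 (m+n≤m⇒n≡0 d (maximal (d + s)
         (closed numS d s d∈S s∈S , subst (_∉ S) (+-assoc y d s) y+d+s∉S)))
  where
  P? : Decidable (λ d → d ∈ S × y + d ∉ S)
  P? d = d ∈? S ×-dec y + d ∉? S
  bound : ∀ d → d ∈ S × y + d ∉ S → d < suc f
  bound d (_ , y+d∉S) = s≤s (≤-trans (m≤n+m d y) (gap≤Frobenius S frob y+d∉S))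
  y+0∉S : y + 0 ∉ S
  y+0∉S = subst (_∉ S) (sym (+-identityʳ y)) y∉S

pseudoFrobenius⇒specialGap : ∀ {S f p} → IsFrobenius S f → f < 2 * p →
                             IsPseudoFrobenius S p → IsSpecialGap S p
pseudoFrobenius⇒specialGap (_ , above) f<2p (p∉S , p+S⊆S) = p∉S , above _ f<2p , p+S⊆S

pseudoFrobenius-belowHalf⇒largerSpecialGap :
  ∀ {S f h} → IsNumSG S → IsFrobenius S f → IsPseudoFrobenius S h → 2 * h < f →
  Σ ℕ λ p → IsSpecialGap S p × p ≢ f × h < p
pseudoFrobenius-belowHalf⇒largerSpecialGap {S} {f} {h} numS frob (h∉S , h+S⊆S) 2h<f =
  let d , d∈S , pf = pseudoFrobenius-above numS frob y∉S
      y≤p = m≤m+n y d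
  in  y + d
    , pseudoFrobenius⇒specialGap frob (f<2p (y + d) y≤p) pf
    , (λ y+d≡f → ∈∧∉⇒⊥ S (subst (_∈ S) (+-cancelˡ-≡ y d h (trans y+d≡f (sym y+h≡f))) d∈S) h∉S)
    , <-≤-trans h<y y≤p
  where
  y : ℕ
  y = f ∸ h
  h+y≡f : h + y ≡ f
  h+y≡f = m+[n∸m]≡n (≤-trans (m≤m+n h (h + 0)) (<⇒≤ 2h<f))
  y+h≡f : y + h ≡ f
  y+h≡f = trans (+-comm y h) h+y≡f
  h<y : h < y
  h<y = +-cancelˡ-< h h y (subst₂ _<_ (2*m≡m+m h) (sym h+y≡f) 2h<f)
  y∉S : y ∉ S
  y∉S = ¬∈⇒∉ S λ y∈S → ∈∧∉⇒⊥ S (subst (_∈ S) h+y≡f (h+S⊆S y y∈S (>⇒≢ (≤-<-trans z≤n h<y))))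
                            (proj₁ frob)
  f<2p : ∀ p → y ≤ p → f < 2 * p
  f<2p p y≤p = subst₂ _<_ h+y≡f (sym (2*m≡m+m p)) (+-mono-<-≤ (<-≤-trans h<y y≤p) y≤p)

maxSpecialGap>halfFrobenius : ∀ {S f h} → IsNumSG S → IsFrobenius S f →
                              IsMax (λ y → IsSpecialGap S y × y ≢ f) h → f < 2 * h
maxSpecialGap>halfFrobenius {S} numS frob (((h∉S , 2h∈S , h+S⊆S) , _) , maximal) =
  ≰⇒> λ 2h≤f →
    let 2h<f = ≤∧≢⇒< 2h≤f λ 2h≡f → ∈∧∉⇒⊥ S (subst (_∈ S) 2h≡f 2h∈S) (proj₁ frob)
        p , sg , p≢f , h<p =
          pseudoFrobenius-belowHalf⇒largerSpecialGap numS frob (h∉S , h+S⊆S) 2h<f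
    in <⇒≱ h<p (maximal p (sg , p≢f))

max[A∖R]-isSpecialGap : ∀ {R A a} → IsNumSG R → IsNumSG A → R ⊆ A →
                        IsMax (λ x → x ∈ A × x ∉ R) a → IsSpecialGap R a
max[A∖R]-isSpecialGap {R} {A} {a} numR numA R⊆A ((a∈A , a∉R) , maximal) =
  a∉R , ¬∉⇒∈ R 2a∉R⇒⊥ , λ s s∈R s≢0 → ¬∉⇒∈ R λ a+s∉R →
    s≢0 (m+n≤m⇒n≡0 a (maximal (a + s) (closed numA a s a∈A (R⊆A s s∈R) , a+s∉R)))
  where
  2a∉R⇒⊥ : 2 * a ∉ R → ⊥
  2a∉R⇒⊥ 2a∉R =
    let a+a≤a = subst (_≤ a) (2*m≡m+m a)
                  (maximal (2 * a)
                    (subst (_∈ A) (sym (2*m≡m+m a)) (closed numA a a a∈A a∈A) , 2a∉R))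
    in ∈∧∉⇒⊥ R (subst (_∈ R) (sym (m+n≤m⇒n≡0 a a+a≤a)) (zero∈ numR)) a∉R

specialGaps≡Frobenius⇒irreducible : ∀ {R f} → IsNumSG R → IsFrobenius R f →
                                     (∀ y → IsSpecialGap R y → y ≡ f) → Irreducible R
specialGaps≡Frobenius⇒irreducible {R} {f} numR frob SG≡f =
  numR , λ (A , B , numA , numB , R⊊A , R⊊B , R≐A∩B) →
    ∈∧∉⇒⊥ R (trans (R≐A∩B f) (cong₂ _∧_ (f∈ numA R⊊A) (f∈ numB R⊊B))) (proj₁ frob)
  where
  f∈ : ∀ {A} → IsNumSG A → R ⊊ A → f ∈ A
  f∈ {A} numA (R⊆A , x , x∈A , x∉R) =
    let a , aMax = maximum (λ a → a ∈? A ×-dec a ∉? R) (suc f)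
                     (λ a (_ , a∉R) → s≤s (gap≤Frobenius R frob a∉R)) x (x∈A , x∉R)
    in subst (_∈ A) (SG≡f a (max[A∖R]-isSpecialGap numR numA R⊆A aMax)) (proj₁ (proj₁ aMax))

reducible⇒maxSpecialGap : ∀ {R f} → IsNumSG R → IsFrobenius R f → ¬ Irreducible R →
                          Σ ℕ (IsMax (λ y → IsSpecialGap R y × y ≢ f))
reducible⇒maxSpecialGap {R} {f} numR frob reducible = byCases (anyUpTo? P? (suc f))
  where
  P : ℕ → Set
  P y = IsSpecialGap R y × y ≢ f
  P? : Decidable P
  P? y = isSpecialGap? frob y ×-dec ¬? (y ≟ f)
  bound : ∀ y → P y → y < suc f
  bound y ((y∉R , _) , _) = s≤s (gap≤Frobenius R frob y∉R)
  byCases : Dec (Σ ℕ λ y → y < suc f × P y) → Σ ℕ (IsMax P)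
  byCases (yes (y , _ , Py)) = maximum P? (suc f) bound y Py
  byCases (no none) = ⊥-elim (reducible (specialGaps≡Frobenius⇒irreducible numR frob λ y sg →
    decidable-stable (y ≟ f) λ y≢f → none (y , bound y (sg , y≢f) , sg , y≢f)))

∪｛｝-isNumSG : ∀ {S h} → IsNumSG S → IsSpecialGap S h → IsNumSG (S ∪｛ h ｝)
∪｛｝-isNumSG {S} {h} numS (_ , 2h∈S , h+S⊆S) = record
  { zero∈    = ∈-∪｛｝⁺ˡ S {h} (zero∈ numS)
  ; closed   = closed′
  ; cofinite = let c , above = cofinite numS in c , λ x c≤x → ∈-∪｛｝⁺ˡ S (above x c≤x)
  }
  where
  h+∈ : ∀ s → s ∈ S → h + s ∈ S ∪｛ h ｝
  h+∈ s s∈S with s ≟ 0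
  ... | yes refl = ∈-∪｛｝⁺ʳ S (+-identityʳ h)
  ... | no s≢0   = ∈-∪｛｝⁺ˡ S (h+S⊆S s s∈S s≢0)
  closed′ : ∀ a b → a ∈ S ∪｛ h ｝ → b ∈ S ∪｛ h ｝ → a + b ∈ S ∪｛ h ｝
  closed′ a b a∈ b∈ with ∈-∪｛｝⁻ S a∈ | ∈-∪｛｝⁻ S b∈
  ... | inj₁ a∈S | inj₁ b∈S = ∈-∪｛｝⁺ˡ S (closed numS a b a∈S b∈S)
  ... | inj₁ a∈S | inj₂ refl = subst (λ x → x ∈ S ∪｛ h ｝) (+-comm h a) (h+∈ a a∈S)
  ... | inj₂ refl | inj₁ b∈S = h+∈ b b∈S
  ... | inj₂ refl | inj₂ refl = ∈-∪｛｝⁺ˡ S (subst (_∈ S) (2*m≡m+m h) 2h∈S)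

∪｛｝-isFrobenius : ∀ {S f h} → IsFrobenius S f → h ≢ f → IsFrobenius (S ∪｛ h ｝) f
∪｛｝-isFrobenius {S} (f∉S , above) h≢f =
  ∉-∪｛｝ S f∉S (≢-sym h≢f) , λ x f<x → ∈-∪｛｝⁺ˡ S (above x f<x)

∪｛｝-isMultiplicity : ∀ {S m h} → IsMultiplicity S m → m < h → IsMultiplicity (S ∪｛ h ｝) m
∪｛｝-isMultiplicity {S} (0<m , m∈S , below) m<h =
  0<m , ∈-∪｛｝⁺ˡ S m∈S , λ x 0<x x<m → ∉-∪｛｝ S (below x 0<x x<m) (<⇒≢ (<-trans x<m m<h))

∪｛｝-isMinimalGenerator : ∀ {S h} → IsNumSG S → h ∉ S → IsMinimalGenerator (S ∪｛ h ｝) h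
∪｛｝-isMinimalGenerator {S} {h} numS h∉S =
  ∈-∪｛｝⁺ʳ S refl , h≢0 ,
  λ (a , b , a∈ , a≢0 , b∈ , b≢0 , a+b≡h) → indecomposable a b a∈ a≢0 b∈ b≢0 a+b≡h
  where
  h≢0 : h ≢ 0
  h≢0 h≡0 = ∈∧∉⇒⊥ S (subst (_∈ S) (sym h≡0) (zero∈ numS)) h∉S
  indecomposable : ∀ a b → a ∈ S ∪｛ h ｝ → a ≢ 0 → b ∈ S ∪｛ h ｝ → b ≢ 0 → a + b ≢ h
  indecomposable a b a∈ a≢0 b∈ b≢0 a+b≡h with ∈-∪｛｝⁻ S a∈ | ∈-∪｛｝⁻ S b∈
  ... | inj₁ a∈S | inj₁ b∈S = ∈∧∉⇒⊥ S (subst (_∈ S) a+b≡h (closed numS a b a∈S b∈S)) h∉S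
  ... | inj₂ refl | _       = b≢0 (m+n≡m⇒n≡0 a a+b≡h)
  ... | inj₁ _ | inj₂ refl  = a≢0 (m+n≡m⇒n≡0 b (trans (+-comm b a) a+b≡h))

∪｛｝-specialGap⇒specialGap : ∀ {S h k} → IsSpecialGap (S ∪｛ h ｝) k → h < k → IsSpecialGap S k
∪｛｝-specialGap⇒specialGap {S} {h} {k} (k∉ , 2k∈ , k+⊆) h<k =
  ¬∈⇒∉ S (λ k∈S → ∈∧∉⇒⊥ (S ∪｛ h ｝) (∈-∪｛｝⁺ˡ S k∈S) k∉) ,
  ∈-above 2k∈ (<-≤-trans h<k (m≤m+n k (k + 0))) ,
  λ s s∈S s≢0 → ∈-above (k+⊆ s (∈-∪｛｝⁺ˡ S s∈S) s≢0) (<-≤-trans h<k (m≤m+n k s))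
  where
  ∈-above : ∀ {x} → x ∈ S ∪｛ h ｝ → h < x → x ∈ S
  ∈-above {x} x∈ h<x with ∈-∪｛｝⁻ S x∈
  ... | inj₁ x∈S = x∈S
  ... | inj₂ x≡h = ⊥-elim (>⇒≢ h<x x≡h)

∖multiplicity-isNumSG : ∀ {S m} → IsNumSG S → IsMultiplicity S m → IsNumSG (S ∖｛ m ｝)
∖multiplicity-isNumSG {S} {m} numS mult@(0<m , _) = record
  { zero∈    = ∈-∖｛｝⁺ S (zero∈ numS) (<⇒≢ 0<m)
  ; closed   = λ a b a∈ b∈ →
      let a∈S , a≢m = ∈-∖｛｝⁻ S a∈
          b∈S , b≢m = ∈-∖｛｝⁻ S b∈
      in ∈-∖｛｝⁺ S (closed numS a b a∈S b∈S) (sum≢m a∈S b∈S a≢m b≢m)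
  ; cofinite = let c , above = cofinite numS in
      suc m + c , λ x 1+m+c≤x →
        ∈-∖｛｝⁺ S (above x (m+n≤o⇒n≤o (suc m) 1+m+c≤x)) (>⇒≢ (m+n≤o⇒m≤o (suc m) 1+m+c≤x))
  }
  where
  sum≢m : ∀ {a b} → a ∈ S → b ∈ S → a ≢ m → b ≢ m → a + b ≢ m
  sum≢m {zero} _ _ _ b≢m = b≢m
  sum≢m {a} {zero} _ _ a≢m _ = a≢m ∘ trans (sym (+-identityʳ a))
  sum≢m {suc a} {suc b} a∈S b∈S _ _ =
    >⇒≢ (<-≤-trans (m<m+n m z<s) (+-monoˡ-≤ (suc b) (multiplicity≤ S mult a∈S λ ())))

∖｛｝-isFrobenius : ∀ {S f m} → IsFrobenius S f → m ≤ f → IsFrobenius (S ∖｛ m ｝) f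
∖｛｝-isFrobenius {S} (f∉S , above) m≤f =
  ∉-∖｛｝ S f∉S , λ x f<x → ∈-∖｛｝⁺ S (above x f<x) (>⇒≢ (≤-<-trans m≤f f<x))

∖｛｝-isSpecialGap : ∀ {S m} → IsNumSG S → m ∈ S → m ≢ 0 → IsSpecialGap (S ∖｛ m ｝) m
∖｛｝-isSpecialGap {S} {m} numS m∈S m≢0 =
  m∉-∖｛m｝ S ,
  ∈-∖｛｝⁺ S (subst (_∈ S) (sym (2*m≡m+m m)) (closed numS m m m∈S m∈S)) 2m≢m ,
  λ s s∈ s≢0 → ∈-∖｛｝⁺ S (closed numS m s m∈S (proj₁ (∈-∖｛｝⁻ S s∈))) (s≢0 ∘ m+n≡m⇒n≡0 m)
  where
  2m≢m : 2 * m ≢ m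
  2m≢m 2m≡m = m≢0 (trans (sym (+-identityʳ m)) (m+n≡m⇒n≡0 m 2m≡m))

∖multiplicity-above : ∀ {S m x} → IsMultiplicity S m → x ∈ S ∖｛ m ｝ → x ≢ 0 → m < x
∖multiplicity-above {S} mult x∈ x≢0 =
  let x∈S , x≢m = ∈-∖｛｝⁻ S x∈ in ≤∧≢⇒< (multiplicity≤ S mult x∈S x≢0) (≢-sym x≢m)

nonSpecial⇒multiplicity<maxSpecialGap : ∀ {S f m h} → ¬ IsSpecial S f m →
                                         IsMax (λ y → IsSpecialGap S y × y ≢ f) h → m < h
nonSpecial⇒multiplicity<maxSpecialGap nonSpecial (_ , maximal) =
  ≰⇒> λ h≤m → nonSpecial λ (y , sg , y≢f , m<y) → <⇒≱ m<y (≤-trans (maximal y (sg , y≢f)) h≤m)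

∪｛｝-specialGap<maxSpecialGap :
  ∀ {S f h k} → IsMax (λ y → IsSpecialGap S y × y ≢ f) h →
  IsSpecialGap (S ∪｛ h ｝) k → k ≢ f → k < h
∪｛｝-specialGap<maxSpecialGap {S} {h = h} (_ , maximal) sg@(k∉ , _) k≢f =
  ≤∧≢⇒< (≮⇒≥ λ h<k → <⇒≱ h<k (maximal _ (∪｛｝-specialGap⇒specialGap sg h<k , k≢f)))
        (λ k≡h → ∈∧∉⇒⊥ (S ∪｛ h ｝) (∈-∪｛｝⁺ʳ S k≡h) k∉)

lemma5p3 : (g n : ℕ) → 3 < g → 2 ≤ n → n ≤ g ∸ 2 →
           (S : Subset) → IsNumSG S →
           (f m : ℕ) → IsFrobenius S f → IsMultiplicity S m →
           HasGenus S g → HasN S f n →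
           ¬ IsSpecial S f m →
           (h : ℕ) → IsMax (λ y → IsSpecialGap S y × y ≢ f) h →
           Σ ℕ λ fT → Σ ℕ λ mT →
             IsNumSG ((S ∪｛ h ｝) ∖｛ m ｝) ×
             IsFrobenius ((S ∪｛ h ｝) ∖｛ m ｝) fT ×
             IsMultiplicity ((S ∪｛ h ｝) ∖｛ m ｝) mT ×
             IsSpecialGap ((S ∪｛ h ｝) ∖｛ m ｝) m ×
             m < mT ×
             IsMinimalGenerator (((S ∪｛ h ｝) ∖｛ m ｝) ∪｛ m ｝) h ×
             (Irreducible (S ∪｛ h ｝) → fT < 2 * h × h < fT) ×
             (¬ Irreducible (S ∪｛ h ｝) →
                Σ ℕ λ k →
                  IsMax (λ y → IsSpecialGap (((S ∪｛ h ｝) ∖｛ m ｝) ∪｛ m ｝) y × y ≢ fT) k ×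
                  k < h × h < fT)
lemma5p3 _ _ _ _ _ S numS f m frob mult _ _ nonSpecial h hMax@((hSG , h≢f) , _) =
  let mT , multT@(0<mT , mT∈T , _) = multiplicity-exists numT
  in  f , mT , numT , frobT , multT
    , ∖｛｝-isSpecialGap numS′ m∈S′ (>⇒≢ 0<m)
    , ∖multiplicity-above multS′ mT∈T (>⇒≢ 0<mT)
    , IsMinimalGenerator-resp-≐ S′≐T∪m (∪｛｝-isMinimalGenerator numS (proj₁ hSG))
    , (λ _ → maxSpecialGap>halfFrobenius numS frob hMax , h<f)
    , λ reducible →
        let k , kMax@((kSG , k≢f) , _) = reducible⇒maxSpecialGap numS′ frobS′ reducible
        in  k
          , IsMax-cong (map₁ (IsSpecialGap-resp-≐ S′≐T∪m))
                       (map₁ (IsSpecialGap-resp-≐ (≐-sym S′≐T∪m))) kMax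
          , ∪｛｝-specialGap<maxSpecialGap hMax kSG k≢f
          , h<f
  where
  0<m : 0 < m
  0<m = proj₁ mult
  m<h : m < h
  m<h = nonSpecial⇒multiplicity<maxSpecialGap nonSpecial hMax
  h<f : h < f
  h<f = specialGap<Frobenius S frob hSG h≢f
  numS′ : IsNumSG (S ∪｛ h ｝)
  numS′ = ∪｛｝-isNumSG numS hSG
  frobS′ : IsFrobenius (S ∪｛ h ｝) f
  frobS′ = ∪｛｝-isFrobenius frob h≢f
  multS′ : IsMultiplicity (S ∪｛ h ｝) m
  multS′ = ∪｛｝-isMultiplicity mult m<h
  m∈S′ : m ∈ S ∪｛ h ｝
  m∈S′ = proj₁ (proj₂ multS′)
  numT : IsNumSG ((S ∪｛ h ｝) ∖｛ m ｝)
  numT = ∖multiplicity-isNumSG numS′ multS′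
  frobT : IsFrobenius ((S ∪｛ h ｝) ∖｛ m ｝) f
  frobT = ∖｛｝-isFrobenius frobS′ (<⇒≤ (<-trans m<h h<f))
  S′≐T∪m : (S ∪｛ h ｝) ≐ (((S ∪｛ h ｝) ∖｛ m ｝) ∪｛ m ｝)
  S′≐T∪m = ≐-sym (∖｛｝-∪｛｝-≐ m∈S′)
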